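{- For $n\ge 1$ let $T_n$ be the unlabelled tree of size $n+1$ whose root has exactly $n$ children. Then the set of circuits $\{C_\sim(T_n,T_n)\mid n\ge1\}$ has unbounded tree-width and unbounded clique-width.
   Context: For unlabelled rooted trees $T_1,T_2$, the Boolean circuit $C_\sim(T_1,T_2)$ is defined as follows. For nodes $u\in V(T_1)$, $v\in V(T_2)$ with $\mathrm{depth}(u)=\mathrm{depth}(v)$ (depth = distance from the root) there is a variable $x_{u,v}$ defined by the equation $x_{u,v}=\bigwedge_{u\to u'}\bigvee_{v\to v'}x_{u',v'}\wedge\bigwedge_{v\to v'}\bigvee_{u\to u'}x_{u',v'}$, where $u\to u'$ ranges over children of $u$, an empty conjunction is the constant $1$ and an empty disjunction is the constant $0$; only variables reachable from $x_{r_1,r_2}$ ($r_i$ the roots) are kept. The circuit is obtained by taking the disjoint union of the formula trees of these right-hand sides and merging each leaf labelled $x_{u',v'}$ with the root of the formula tree of $x_{u',v'}$. Tree-width and clique-width of a circuit refer to those of its underlying undirected graph (standard notions). -}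

module Defs where

open import Data.Nat using (ℕ; zero; suc; _≤_)
open import Data.Fin using (Fin; _≟_)
open import Data.List using (List; []; _∷_; length; lookup; replicate)
open import Data.List.Relation.Unary.Any using (Any)
open import Data.List.Relation.Unary.All using (All)
open import Data.List.Membership.Propositional using (_∈_)
open import Data.Product using (Σ; _×_; _,_; ∃)
open import Data.Sum using (_⊎_; inj₁; inj₂)
open import Data.Unit using (⊤)
open import Data.Empty using (⊥)
open import Relation.Nullary using (¬_; yes; no)
open import Relation.Binary.PropositionalEquality using (_≡_; _≢_)
open import Function.Bundles using (_↔_; Inverse; _⇔_)

data Tree : Set where
  node : List Tree → Tree

children : Tree → List Tree
children (node cs) = cs

T : ℕ → Tree
T n = node (replicate n (node []))

-- Nodes of a tree at depth d (distance from the root), as root paths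
data Pos : Tree → ℕ → Set where
  here  : ∀ {t} → Pos t zero
  there : ∀ {cs d} (i : Fin (length cs)) → Pos (lookup cs i) d → Pos (node cs) (suc d)

sub : ∀ {t d} → Pos t d → Tree
sub {t} here = t
sub (there i p) = sub p

arity : ∀ {t d} → Pos t d → ℕ
arity p = length (children (sub p))

child : ∀ {t d} (p : Pos t d) → Fin (arity p) → Pos t (suc d)
child {node cs} here i = there i here
child (there j p) i = there j (child p i)

record Graph : Set₁ where
  field
    V : Set
    E : V → V → Set

Adj : (G : Graph) → Graph.V G → Graph.V G → Set
Adj G x y = Graph.E G x y ⊎ Graph.E G y x

-- For a same-depth pair (u,v) the formula
--   x_{u,v} = (⋀_{u→u'} ⋁_{v→v'} x_{u',v'}) ∧ (⋀_{v→v'} ⋁_{u→u'} x_{u',v'})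
-- has gates: top (the binary ∧), andL/andR (the two big conjunctions,
-- a 0-ary one being the constant 1), orL u' / orR v' (the disjunctions,
-- a 0-ary one being the constant 0); leaves x_{u',v'} are merged with
-- the gate `top u' v'`.  Every same-depth pair is reachable from the
-- root pair, so all of them are kept.

data CV (T₁ T₂ : Tree) : Set where
  top  : ∀ {d} → Pos T₁ d → Pos T₂ d → CV T₁ T₂
  andL : ∀ {d} → Pos T₁ d → Pos T₂ d → CV T₁ T₂
  andR : ∀ {d} → Pos T₁ d → Pos T₂ d → CV T₁ T₂
  orL  : ∀ {d} (u : Pos T₁ d) → Pos T₂ d → Fin (arity u) → CV T₁ T₂
  orR  : ∀ {d} → Pos T₁ d → (v : Pos T₂ d) → Fin (arity v) → CV T₁ T₂

-- wires of the circuit (directed from gate to input)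
data Wire {T₁ T₂ : Tree} : CV T₁ T₂ → CV T₁ T₂ → Set where
  top-andL : ∀ {d} {u : Pos T₁ d} {v : Pos T₂ d} → Wire (top u v) (andL u v)
  top-andR : ∀ {d} {u : Pos T₁ d} {v : Pos T₂ d} → Wire (top u v) (andR u v)
  andL-or  : ∀ {d} {u : Pos T₁ d} {v : Pos T₂ d} (i : Fin (arity u)) →
             Wire (andL u v) (orL u v i)
  andR-or  : ∀ {d} {u : Pos T₁ d} {v : Pos T₂ d} (j : Fin (arity v)) →
             Wire (andR u v) (orR u v j)
  orL-top  : ∀ {d} {u : Pos T₁ d} {v : Pos T₂ d} (i : Fin (arity u)) (j : Fin (arity v)) →
             Wire (orL u v i) (top (child u i) (child v j))
  orR-top  : ∀ {d} {u : Pos T₁ d} {v : Pos T₂ d} (i : Fin (arity u)) (j : Fin (arity v)) →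
             Wire (orR u v j) (top (child u i) (child v j))

Circuit∼ : Tree → Tree → Graph
Circuit∼ T₁ T₂ = record { V = CV T₁ T₂ ; E = Wire }

data DTree (V : Set) : Set where
  dnode : List V → List (DTree V) → DTree V

module _ {V : Set} where

  data SomeBag (P : List V → Set) : DTree V → Set where
    atRoot : ∀ {b cs} → P b → SomeBag P (dnode b cs)
    below  : ∀ {b cs} → Any (SomeBag P) cs → SomeBag P (dnode b cs)

  data AllBags (P : List V → Set) : DTree V → Set where
    allb : ∀ {b cs} → P b → All (AllBags P) cs → AllBags P (dnode b cs)

  Occurs : V → DTree V → Set
  Occurs v = SomeBag (v ∈_)

  -- v is in the root bag and the nodes containing v form a subtree
  -- containing the root
  data RootConn (v : V) : DTree V → Set where
    rc : ∀ {b cs} → v ∈ b → All (λ c → ¬ Occurs v c ⊎ RootConn v c) cs →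
         RootConn v (dnode b cs)

  -- the nodes whose bag contains v induce a connected subgraph
  data Conn (v : V) : DTree V → Set where
    absent : ∀ {t} → ¬ Occurs v t → Conn v t
    atTop  : ∀ {t} → RootConn v t → Conn v t
    down   : ∀ {b cs} → ¬ (v ∈ b) → (i : Fin (length cs)) → Conn v (lookup cs i) →
             (∀ j → j ≢ i → ¬ Occurs v (lookup cs j)) → Conn v (dnode b cs)

record TreeDecomposition (G : Graph) : Set where
  field
    tree     : DTree (Graph.V G)
    vertices : ∀ v → Occurs v tree
    edges    : ∀ x y → Adj G x y → SomeBag (λ b → x ∈ b × y ∈ b) tree
    connected : ∀ v → Conn v tree

TreeWidth≤ : ℕ → Graph → Set
TreeWidth≤ k G = Σ (TreeDecomposition G) λ D →
  AllBags (λ b → length b ≤ suc k) (TreeDecomposition.tree D)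

data Expr (k : ℕ) : Set where
  vert : Fin k → Expr k
  _⊕_  : Expr k → Expr k → Expr k
  η    : (i j : Fin k) → i ≢ j → Expr k → Expr k
  ρ    : (i j : Fin k) → Expr k → Expr k

Vtx : ∀ {k} → Expr k → Set
Vtx (vert i) = ⊤
Vtx (e ⊕ f) = Vtx e ⊎ Vtx f
Vtx (η i j _ e) = Vtx e
Vtx (ρ i j e) = Vtx e

lab : ∀ {k} (e : Expr k) → Vtx e → Fin k
lab (vert i) _ = i
lab (e ⊕ f) (inj₁ x) = lab e x
lab (e ⊕ f) (inj₂ y) = lab f y
lab (η i j _ e) x = lab e x
lab (ρ i j e) x with lab e x ≟ i
... | yes _ = j
... | no _ = lab e x

Edge : ∀ {k} (e : Expr k) → Vtx e → Vtx e → Set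
Edge (vert i) _ _ = ⊥
Edge (e ⊕ f) (inj₁ x) (inj₁ y) = Edge e x y
Edge (e ⊕ f) (inj₁ x) (inj₂ y) = ⊥
Edge (e ⊕ f) (inj₂ x) (inj₁ y) = ⊥
Edge (e ⊕ f) (inj₂ x) (inj₂ y) = Edge f x y
Edge (η i j _ e) x y =
  Edge e x y ⊎ ((lab e x ≡ i × lab e y ≡ j) ⊎ (lab e x ≡ j × lab e y ≡ i))
Edge (ρ i j e) x y = Edge e x y

CliqueWidth≤ : ℕ → Graph → Set
CliqueWidth≤ k G = Σ (Expr k) λ e → Σ (Graph.V G ↔ Vtx e) λ f →
  ∀ x y → Adj G x y ⇔ Edge e (Inverse.to f x) (Inverse.to f y)

module Submission where

-- Write r for the root and ℓ₁ … ℓₙ for the leaves of T n.  The n disjunctions ⋁_{v'} x_{ℓᵢ,v'}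
-- and the n disjunctions ⋁_{u'} x_{u',ℓⱼ} of the formula for x_{r,r}, joined through the n² gates
-- x_{ℓᵢ,ℓⱼ}, form a subdivided K_{n,n} (rows, columns and cells).
--
-- Tree-width: a bag of at most k+1 < n vertices misses a whole row and a column hub, so if all
-- cells of some column occur in the subtree at a node, then all cells of some column occur in the
-- subtree at a single child; this descends forever in a finite decomposition.
--
-- Clique-width: in a k-expression, vertices of a subexpression with equal labels have the same
-- neighbours outside it.  Hence for a row or column that is cut by a subexpression, the label of
-- the part inside determines the line, so the two sides of a disjoint union cut at most 4k < n
-- rows and 4k columns, and some row and some column avoid both sides.  So if the union contains a
-- whole row or column, one of its sides already does; descending from the whole expression, which
-- contains every row, we would reach a single vertex containing a whole row or column.

open import Defs
open import Data.Nat using (ℕ; suc; _≤_; _<_; _*_; z≤n; s≤s)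
open import Data.Nat.Properties using (≤-reflexive; ≤-<-trans; <⇒≱)
open import Data.Fin using (Fin; _≟_; combine; fromℕ<)
  renaming (zero to fzero; suc to fsuc)
open import Data.Fin.Properties using (any?; all?; ¬∀⟶∃¬; injective⇒≤; combine-injective)
open import Data.List using (List; []; _∷_; length; lookup; replicate)
open import Data.List.Properties using (length-replicate)
open import Data.List.Relation.Unary.Any as Any using (Any; index)
open import Data.List.Relation.Unary.Any.Properties using (lookup-index)
open import Data.List.Relation.Unary.All as All using (All; []; _∷_)
open import Data.List.Membership.Propositional using (_∈_; _∉_; lose)
open import Data.List.Membership.Propositional.Properties using (∈-lookup)
open import Data.Maybe using (Maybe; just; nothing)
open import Data.Maybe.Properties as Maybe using (just-injective)
open import Data.Product using (Σ; _×_; _,_; proj₁; proj₂; map₂)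
open import Data.Sum using (_⊎_; inj₁; inj₂; [_,_]′; swap)
open import Data.Unit using (⊤; tt)
open import Data.Empty using (⊥; ⊥-elim)
open import Function using (_∘_)
open import Function.Bundles using (Inverse; Equivalence)
open import Relation.Nullary using (¬_; Dec; yes; no)
open import Relation.Nullary.Decidable using (¬?; _×-dec_; decidable-stable)
open import Relation.Binary.PropositionalEquality
  using (_≡_; _≢_; refl; sym; trans; cong; subst; module ≡-Reasoning)

short-list-misses-value : ∀ {A : Set} {m} (f : A → Maybe (Fin m)) (xs : List A) → length xs < m →
                          Σ (Fin m) λ i → ∀ {x} → x ∈ xs → f x ≢ just i
short-list-misses-value {m = m} f xs |xs|<m
  with ¬∀⟶∃¬ m Hit (λ i → Any.any? (λ x → Maybe.≡-dec _≟_ (f x) (just i)) xs) not-all-hit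
  where
  Hit : Fin m → Set
  Hit i = Any (λ x → f x ≡ just i) xs
  not-all-hit : ¬ (∀ i → Hit i)
  not-all-hit hit = <⇒≱ |xs|<m (injective⇒≤ {f = index ∘ hit} same-position)
    where
    same-position : ∀ {i i'} → index (hit i) ≡ index (hit i') → i ≡ i'
    same-position {i} {i'} eq = just-injective (begin
      just i                          ≡⟨ sym (lookup-index (hit i)) ⟩
      f (lookup xs (index (hit i)))   ≡⟨ cong (f ∘ lookup xs) eq ⟩
      f (lookup xs (index (hit i')))  ≡⟨ lookup-index (hit i') ⟩
      just i'                         ∎)
      where open ≡-Reasoning
... | i , not-hit = i , λ x∈xs fx≡i → not-hit (lose x∈xs fx≡i)

DTree-induction : ∀ {V : Set} (P : DTree V → Set) →
                  (∀ B cs → All P cs → P (dnode B cs)) → ∀ t → P t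
DTree-induction P step = go
  where
  mutual
    go : ∀ t → P t
    go (dnode B cs) = step B cs (go-all cs)

    go-all : ∀ cs → All P cs
    go-all []       = []
    go-all (c ∷ cs) = go c ∷ go-all cs

module _ {V : Set} where

  private variable
    v : V
    B : List V
    cs : List (DTree V)

  bag : DTree V → List V
  bag (dnode B _) = B

  mutual
    SomeBag-map : ∀ {P Q : List V → Set} → (∀ {B} → P B → Q B) →
                  ∀ {t} → SomeBag P t → SomeBag Q t
    SomeBag-map f (atRoot p)  = atRoot (f p)
    SomeBag-map f (below ps) = below (Any-SomeBag-map f ps)

    Any-SomeBag-map : ∀ {P Q : List V → Set} → (∀ {B} → P B → Q B) →
                      ∀ {ts} → Any (SomeBag P) ts → Any (SomeBag Q) ts
    Any-SomeBag-map f (Any.here p)   = Any.here (SomeBag-map f p)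
    Any-SomeBag-map f (Any.there ps) = Any.there (Any-SomeBag-map f ps)

  occurs-child : (j : Fin (length cs)) → Occurs v (lookup cs j) → Occurs v (dnode B cs)
  occurs-child j o = below (lose (∈-lookup j) o)

  occurs-in-child : Occurs v (dnode B cs) → v ∉ B →
                    Σ (Fin (length cs)) λ j → Occurs v (lookup cs j)
  occurs-in-child (atRoot v∈B) v∉B = ⊥-elim (v∉B v∈B)
  occurs-in-child (below o)    _   = index o , lookup-index o

  RootConn⇒∈bag : ∀ {t} → RootConn v t → v ∈ bag t
  RootConn⇒∈bag (rc v∈B _) = v∈B

  Conn-child : Conn v (dnode B cs) → ∀ j → Conn v (lookup cs j)
  Conn-child (absent ¬o) j = absent (¬o ∘ occurs-child j)
  Conn-child (atTop (rc _ children)) j with All.lookup children (∈-lookup j)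
  ... | inj₁ ¬o = absent ¬o
  ... | inj₂ r  = atTop r
  Conn-child (down _ i c others) j with j ≟ i
  ... | yes refl = c
  ... | no j≢i   = absent (others j j≢i)

  Conn-child-∈bag : Conn v (dnode B cs) → v ∈ B →
                    ∀ {j} → Occurs v (lookup cs j) → v ∈ bag (lookup cs j)
  Conn-child-∈bag (absent ¬o) _ {j} o = ⊥-elim (¬o (occurs-child j o))
  Conn-child-∈bag (atTop (rc _ children)) _ {j} o with All.lookup children (∈-lookup j)
  ... | inj₁ ¬o = ⊥-elim (¬o o)
  ... | inj₂ r  = RootConn⇒∈bag r
  Conn-child-∈bag (down v∉B _ _ _) v∈B _ = ⊥-elim (v∉B v∈B)

  occurs-child-unique : Conn v (dnode B cs) → v ∉ B → ∀ {j j'} →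
                        Occurs v (lookup cs j) → Occurs v (lookup cs j') → j ≡ j'
  occurs-child-unique (absent ¬o) _ {j} o _ = ⊥-elim (¬o (occurs-child j o))
  occurs-child-unique (atTop r) v∉B _ _ = ⊥-elim (v∉B (RootConn⇒∈bag r))
  occurs-child-unique (down _ i _ others) _ {j} {j'} o o' with j ≟ i | j' ≟ i
  ... | yes j≡i | yes j'≡i = trans j≡i (sym j'≡i)
  ... | no j≢i  | _        = ⊥-elim (others j j≢i o)
  ... | _       | no j'≢i  = ⊥-elim (others j' j'≢i o')

module Decomposition (G : Graph) where

  open Graph G using (V)

  private variable
    u v : V
    B : List V
    cs : List (DTree V)

  -- The edge condition in a form inherited by subtrees: an edge at a vertex occurring in t
  -- only below the root of t is covered by a bag of t.
  EdgesCovered : DTree V → Set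
  EdgesCovered t = ∀ {u v} → Adj G u v → Occurs u t → u ∉ bag t → SomeBag (λ B → u ∈ B × v ∈ B) t

  Coherent : DTree V → Set
  Coherent t = (∀ v → Conn v t) × EdgesCovered t

  decomposition-coherent : (D : TreeDecomposition G) → Coherent (TreeDecomposition.tree D)
  decomposition-coherent D = connected , λ {u} {v} u~v _ _ → edges u v u~v
    where open TreeDecomposition D

  edge-covered-in-same-child : ∀ {j} → Coherent (dnode B cs) →
                               Occurs u (lookup cs j) → u ∉ B → Adj G u v →
                               SomeBag (λ B → u ∈ B × v ∈ B) (lookup cs j)
  edge-covered-in-same-child {cs = cs} {u = u} {j = j} (conn , covered) o u∉B u~v
    with covered u~v (occurs-child j o) u∉B
  ... | atRoot (u∈B , _) = ⊥-elim (u∉B u∈B)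
  ... | below p = subst (λ i → SomeBag _ (lookup cs i))
                        (occurs-child-unique (conn u) u∉B (SomeBag-map proj₁ (lookup-index p)) o)
                        (lookup-index p)

  neighbour-occurs-in-same-child : ∀ {j} → Coherent (dnode B cs) →
                                   Occurs u (lookup cs j) → u ∉ B → Adj G u v → Occurs v (lookup cs j)
  neighbour-occurs-in-same-child coh o u∉B u~v =
    SomeBag-map proj₂ (edge-covered-in-same-child coh o u∉B u~v)

  Coherent-child : Coherent (dnode B cs) → ∀ j → Coherent (lookup cs j)
  Coherent-child coh@(conn , _) j = (λ v → Conn-child (conn v) j) , covered
    where
    covered : EdgesCovered _
    covered {u} u~v o u∉bag =
      edge-covered-in-same-child coh o (λ u∈B → u∉bag (Conn-child-∈bag (conn u) u∈B o)) u~v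

-- The subdivision of the complete bipartite graph K_{m,m}: the edge between the i-th row hub and
-- the j-th column hub is subdivided by the vertex `cell i j`.
record SubdividedBiclique (G : Graph) (m : ℕ) : Set where
  field
    rowHub colHub : Fin m → Graph.V G
    cell          : Fin m → Fin m → Graph.V G
    rowHub-cell   : ∀ i j → Adj G (rowHub i) (cell i j)
    colHub-cell   : ∀ i j → Adj G (colHub j) (cell i j)

-- The rows (a row hub with its cells) are pairwise disjoint, and so are the column hubs.
record RowsSeparated {G : Graph} {m : ℕ} (S : SubdividedBiclique G m) : Set where
  open SubdividedBiclique S
  field
    rowOf colOf  : Graph.V G → Maybe (Fin m)
    rowOf-rowHub : ∀ i → rowOf (rowHub i) ≡ just i
    rowOf-cell   : ∀ i j → rowOf (cell i j) ≡ just i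
    colOf-colHub : ∀ j → colOf (colHub j) ≡ just j

record OnlyOwnHubs {G : Graph} {m : ℕ} (S : SubdividedBiclique G m) : Set where
  open SubdividedBiclique S
  field
    rowHub-unique : ∀ {i' i j} → Adj G (rowHub i') (cell i j) → i' ≡ i
    colHub-unique : ∀ {j' i j} → Adj G (colHub j') (cell i j) → j' ≡ j

Adj-sym : ∀ (G : Graph) {x y} → Adj G x y → Adj G y x
Adj-sym G = swap

module _ {G : Graph} {m : ℕ} (S : SubdividedBiclique G m) (R : RowsSeparated S) where

  open SubdividedBiclique S
  open RowsSeparated R
  open Decomposition G

  ColumnInside : DTree (Graph.V G) → Set
  ColumnInside t = Σ (Fin m) λ j → ∀ i → Occurs (cell i j) t

  missed-row : ∀ {B} → length B < m → Σ (Fin m) λ i → rowHub i ∉ B × (∀ j → cell i j ∉ B)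
  missed-row {B} |B|<m with short-list-misses-value rowOf B |B|<m
  ... | i , row-free =
    i , (λ h∈B → row-free h∈B (rowOf-rowHub i)) , λ j c∈B → row-free c∈B (rowOf-cell i j)

  missed-colHub : ∀ {B} → length B < m → Σ (Fin m) λ j → colHub j ∉ B
  missed-colHub {B} |B|<m with short-list-misses-value colOf B |B|<m
  ... | j , col-free = j , λ h∈B → col-free h∈B (colOf-colHub j)

  -- With row i and column hub j missed by the bag, the path from column j₀ through row hub i, cell
  -- (i , j) and column hub j to all of column j stays below the bag, hence inside a single child.
  column-inside-child : ∀ {B cs} → Coherent (dnode B cs) → length B < m →
                        ColumnInside (dnode B cs) → Σ (Fin (length cs)) λ c → ColumnInside (lookup cs c)
  column-inside-child {B} {cs} coh |B|<m (j₀ , column)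
    with missed-row |B|<m | missed-colHub |B|<m
  ... | i , rowHub∉B , cell∉B | j , colHub∉B
    with occurs-in-child (column i) (cell∉B j₀)
  ... | c , cell-i-j₀ = c , j , λ i' → spread colHub-j colHub∉B (colHub-cell i' j)
    where
    spread : ∀ {u v} → Occurs u (lookup cs c) → u ∉ B → Adj G u v → Occurs v (lookup cs c)
    spread = neighbour-occurs-in-same-child coh
    rowHub-i : Occurs (rowHub i) (lookup cs c)
    rowHub-i = spread cell-i-j₀ (cell∉B j₀) (Adj-sym G (rowHub-cell i j₀))
    colHub-j : Occurs (colHub j) (lookup cs c)
    colHub-j = spread (spread rowHub-i rowHub∉B (rowHub-cell i j))
                      (cell∉B j) (Adj-sym G (colHub-cell i j))

  treewidth-lower-bound : ∀ {k} → suc k < m → ¬ TreeWidth≤ k G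
  treewidth-lower-bound {k} k<m (D , small) =
    DTree-induction NoColumnInside step tree
      (decomposition-coherent D) small (j₀ , λ i → vertices (cell i j₀))
    where
    open TreeDecomposition D
    j₀ : Fin m
    j₀ = fromℕ< k<m
    Small : List (Graph.V G) → Set
    Small B = length B ≤ suc k
    NoColumnInside : DTree (Graph.V G) → Set
    NoColumnInside t = Coherent t → AllBags Small t → ¬ ColumnInside t
    step : ∀ B cs → All NoColumnInside cs → NoColumnInside (dnode B cs)
    step B cs ih coh (allb |B|≤ small-below) inside =
      ih-c (Coherent-child coh c) (All.lookup small-below (∈-lookup c)) (proj₂ into-child)
      where
      into-child : Σ (Fin (length cs)) λ c → ColumnInside (lookup cs c)
      into-child = column-inside-child coh (≤-<-trans |B|≤ k<m) inside
      c : Fin (length cs)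
      c = proj₁ into-child
      ih-c : NoColumnInside (lookup cs c)
      ih-c = All.lookup ih (∈-lookup c)

module _ {k : ℕ} where

  infix 4 _⊑_

  data _⊑_ (a : Expr k) : Expr k → Set where
    ⊑-refl : a ⊑ a
    ⊑-⊕ˡ   : ∀ {e f} → a ⊑ e → a ⊑ e ⊕ f
    ⊑-⊕ʳ   : ∀ {e f} → a ⊑ f → a ⊑ e ⊕ f
    ⊑-η    : ∀ {i j i≢j e} → a ⊑ e → a ⊑ η i j i≢j e
    ⊑-ρ    : ∀ {i j e} → a ⊑ e → a ⊑ ρ i j e

  private variable
    a b e : Expr k

  ⊑-trans : a ⊑ b → b ⊑ e → a ⊑ e
  ⊑-trans s ⊑-refl   = s
  ⊑-trans s (⊑-⊕ˡ t) = ⊑-⊕ˡ (⊑-trans s t)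
  ⊑-trans s (⊑-⊕ʳ t) = ⊑-⊕ʳ (⊑-trans s t)
  ⊑-trans s (⊑-η t)  = ⊑-η (⊑-trans s t)
  ⊑-trans s (⊑-ρ t)  = ⊑-ρ (⊑-trans s t)

  embed : a ⊑ e → Vtx a → Vtx e
  embed ⊑-refl   x = x
  embed (⊑-⊕ˡ s) x = inj₁ (embed s x)
  embed (⊑-⊕ʳ s) x = inj₂ (embed s x)
  embed (⊑-η s)  x = embed s x
  embed (⊑-ρ s)  x = embed s x

  Inside : a ⊑ e → Vtx e → Set
  Inside ⊑-refl   _        = ⊤
  Inside (⊑-⊕ˡ s) (inj₁ z) = Inside s z
  Inside (⊑-⊕ˡ s) (inj₂ _) = ⊥
  Inside (⊑-⊕ʳ s) (inj₁ _) = ⊥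
  Inside (⊑-⊕ʳ s) (inj₂ z) = Inside s z
  Inside (⊑-η s)  z        = Inside s z
  Inside (⊑-ρ s)  z        = Inside s z

  inside? : (s : a ⊑ e) (z : Vtx e) → Dec (Inside s z)
  inside? ⊑-refl   _        = yes tt
  inside? (⊑-⊕ˡ s) (inj₁ z) = inside? s z
  inside? (⊑-⊕ˡ s) (inj₂ _) = no λ ()
  inside? (⊑-⊕ʳ s) (inj₁ _) = no λ ()
  inside? (⊑-⊕ʳ s) (inj₂ z) = inside? s z
  inside? (⊑-η s)  z        = inside? s z
  inside? (⊑-ρ s)  z        = inside? s z

  inside-preimage : ∀ {z} (s : a ⊑ e) → Inside s z → Σ (Vtx a) λ w → embed s w ≡ z
  inside-preimage {z = z} ⊑-refl _ = z , refl
  inside-preimage {z = inj₁ _} (⊑-⊕ˡ s) p = map₂ (cong inj₁) (inside-preimage s p)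
  inside-preimage {z = inj₂ _} (⊑-⊕ʳ s) p = map₂ (cong inj₂) (inside-preimage s p)
  inside-preimage (⊑-η s) p = inside-preimage s p
  inside-preimage (⊑-ρ s) p = inside-preimage s p

  inside-⊑-trans : (s : a ⊑ b) (t : b ⊑ e) {w : Vtx b} → Inside s w → Inside (⊑-trans s t) (embed t w)
  inside-⊑-trans s ⊑-refl   p = p
  inside-⊑-trans s (⊑-⊕ˡ t) p = inside-⊑-trans s t p
  inside-⊑-trans s (⊑-⊕ʳ t) p = inside-⊑-trans s t p
  inside-⊑-trans s (⊑-η t)  p = inside-⊑-trans s t p
  inside-⊑-trans s (⊑-ρ t)  p = inside-⊑-trans s t p

  ⊑-⊕⁻ˡ : a ⊕ b ⊑ e → a ⊑ e
  ⊑-⊕⁻ˡ = ⊑-trans (⊑-⊕ˡ ⊑-refl)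

  ⊑-⊕⁻ʳ : a ⊕ b ⊑ e → b ⊑ e
  ⊑-⊕⁻ʳ = ⊑-trans (⊑-⊕ʳ ⊑-refl)

  ⊑-η⁻ : ∀ {i j i≢j} → η i j i≢j a ⊑ e → a ⊑ e
  ⊑-η⁻ = ⊑-trans (⊑-η ⊑-refl)

  ⊑-ρ⁻ : ∀ {i j} → ρ i j a ⊑ e → a ⊑ e
  ⊑-ρ⁻ = ⊑-trans (⊑-ρ ⊑-refl)

  inside-⊕⁻ : (s : a ⊕ b ⊑ e) {z : Vtx e} → Inside s z → Inside (⊑-⊕⁻ˡ s) z ⊎ Inside (⊑-⊕⁻ʳ s) z
  inside-⊕⁻ s p with inside-preimage s p
  ... | inj₁ w , refl = inj₁ (inside-⊑-trans (⊑-⊕ˡ ⊑-refl) s tt)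
  ... | inj₂ w , refl = inj₂ (inside-⊑-trans (⊑-⊕ʳ ⊑-refl) s tt)

  inside-η⁻ : ∀ {i j i≢j} (s : η i j i≢j a ⊑ e) {z : Vtx e} → Inside s z → Inside (⊑-η⁻ s) z
  inside-η⁻ s p with inside-preimage s p
  ... | w , refl = inside-⊑-trans (⊑-η ⊑-refl) s tt

  inside-ρ⁻ : ∀ {i j} (s : ρ i j a ⊑ e) {z : Vtx e} → Inside s z → Inside (⊑-ρ⁻ s) z
  inside-ρ⁻ s p with inside-preimage s p
  ... | w , refl = inside-⊑-trans (⊑-ρ ⊑-refl) s tt

  inside-vert-unique : ∀ {l} (s : vert l ⊑ e) {y z} → Inside s y → Inside s z → y ≡ z
  inside-vert-unique s p q with inside-preimage s p | inside-preimage s q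
  ... | tt , refl | tt , refl = refl

  relabel : Fin k → Fin k → Fin k → Fin k
  relabel i j l with l ≟ i
  ... | yes _ = j
  ... | no _  = l

  lab-ρ : ∀ i j (a : Expr k) x → lab (ρ i j a) x ≡ relabel i j (lab a x)
  lab-ρ i j a x with lab a x ≟ i
  ... | yes _ = refl
  ... | no _  = refl

  lab-embed-cong : (s : a ⊑ e) {x y : Vtx a} → lab a x ≡ lab a y → lab e (embed s x) ≡ lab e (embed s y)
  lab-embed-cong ⊑-refl   eq = eq
  lab-embed-cong (⊑-⊕ˡ s) eq = lab-embed-cong s eq
  lab-embed-cong (⊑-⊕ʳ s) eq = lab-embed-cong s eq
  lab-embed-cong (⊑-η s)  eq = lab-embed-cong s eq
  lab-embed-cong {e = ρ i j e} (⊑-ρ s) {x} {y} eq = begin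
    lab (ρ i j e) (embed s x)    ≡⟨ lab-ρ i j e (embed s x) ⟩
    relabel i j (lab e (embed s x)) ≡⟨ cong (relabel i j) (lab-embed-cong s eq) ⟩
    relabel i j (lab e (embed s y)) ≡⟨ sym (lab-ρ i j e (embed s y)) ⟩
    lab (ρ i j e) (embed s y)    ∎
    where open ≡-Reasoning

  Edge-irrefl : ∀ (e : Expr k) {x} → ¬ Edge e x x
  Edge-irrefl (vert _) ()
  Edge-irrefl (e ⊕ f) {inj₁ x} ε = Edge-irrefl e ε
  Edge-irrefl (e ⊕ f) {inj₂ x} ε = Edge-irrefl f ε
  Edge-irrefl (η i j i≢j e) (inj₁ ε) = Edge-irrefl e ε
  Edge-irrefl (η i j i≢j e) (inj₂ (inj₁ (x≡i , x≡j))) = i≢j (trans (sym x≡i) x≡j)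
  Edge-irrefl (η i j i≢j e) (inj₂ (inj₂ (x≡j , x≡i))) = i≢j (trans (sym x≡i) x≡j)
  Edge-irrefl (ρ i j e) ε = Edge-irrefl e ε

  Edge-sym : ∀ (e : Expr k) {x y} → Edge e x y → Edge e y x
  Edge-sym (vert _) ()
  Edge-sym (e ⊕ f) {inj₁ x} {inj₁ y} ε = Edge-sym e ε
  Edge-sym (e ⊕ f) {inj₂ x} {inj₂ y} ε = Edge-sym f ε
  Edge-sym (η i j i≢j e) (inj₁ ε) = inj₁ (Edge-sym e ε)
  Edge-sym (η i j i≢j e) (inj₂ (inj₁ (x≡i , y≡j))) = inj₂ (inj₂ (y≡j , x≡i))
  Edge-sym (η i j i≢j e) (inj₂ (inj₂ (x≡j , y≡i))) = inj₂ (inj₁ (y≡i , x≡j))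
  Edge-sym (ρ i j e) ε = Edge-sym e ε

  -- Every later operation treats equally labelled vertices alike.
  same-label⇒same-outer-edges : (s : a ⊑ e) {x y : Vtx a} → lab a x ≡ lab a y →
                                ∀ {z} → ¬ Inside s z → Edge e (embed s x) z → Edge e (embed s y) z
  same-label⇒same-outer-edges ⊑-refl _ z∉ _ = ⊥-elim (z∉ tt)
  same-label⇒same-outer-edges (⊑-⊕ˡ s) eq {inj₁ z} z∉ ε = same-label⇒same-outer-edges s eq z∉ ε
  same-label⇒same-outer-edges (⊑-⊕ʳ s) eq {inj₂ z} z∉ ε = same-label⇒same-outer-edges s eq z∉ ε
  same-label⇒same-outer-edges (⊑-η s) eq z∉ (inj₁ ε) = inj₁ (same-label⇒same-outer-edges s eq z∉ ε)
  same-label⇒same-outer-edges (⊑-η s) eq z∉ (inj₂ (inj₁ (x≡i , z≡j))) =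
    inj₂ (inj₁ (trans (sym (lab-embed-cong s eq)) x≡i , z≡j))
  same-label⇒same-outer-edges (⊑-η s) eq z∉ (inj₂ (inj₂ (x≡j , z≡i))) =
    inj₂ (inj₂ (trans (sym (lab-embed-cong s eq)) x≡j , z≡i))
  same-label⇒same-outer-edges (⊑-ρ s) eq z∉ ε = same-label⇒same-outer-edges s eq z∉ ε

-- A family of m stars in the graph of a k-expression: line r is the hub r joined to its members.
module Lines {k m : ℕ} (e : Expr k) (hub : Fin m → Vtx e) (member : Fin m → Fin m → Vtx e)
             (hub-member : ∀ r j → Edge e (hub r) (member r j))
             (hub-unique : ∀ {r' r j} → Edge e (hub r') (member r j) → r' ≡ r) where

  private variable
    a b : Expr k

  Full : a ⊑ e → Fin m → Set
  Full s r = Inside s (hub r) × (∀ j → Inside s (member r j))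

  Untouched : a ⊑ e → Fin m → Set
  Untouched s r = ∀ j → ¬ Inside s (member r j)

  untouched? : (s : a ⊑ e) → ∀ r → Dec (Untouched s r)
  untouched? s r = all? λ j → ¬? (inside? s (member r j))

  Full-mono : {s : a ⊑ e} {s' : b ⊑ e} → (∀ {z} → Inside s z → Inside s' z) →
              ∀ {r} → Full s r → Full s' r
  Full-mono s⊆s' (h , ms) = s⊆s' h , λ j → s⊆s' (ms j)

  Full-vert : ∀ {l} (s : vert l ⊑ e) r → ¬ Full s r
  Full-vert s r (h , ms) =
    Edge-irrefl e (subst (Edge e (hub r)) (sym (inside-vert-unique s h (ms r))) (hub-member r r))

  -- Line r is cut by s with the hub inside (kind 0) or with a member inside (kind 1), the part
  -- inside carrying label l.
  Cut : a ⊑ e → Fin m → Fin 2 → Fin k → Set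
  Cut {a} s r fzero l =
    Σ (Vtx a) λ w → embed s w ≡ hub r × lab a w ≡ l × Σ (Fin m) λ j → ¬ Inside s (member r j)
  Cut {a} s r (fsuc fzero) l =
    Σ (Vtx a) λ w → Σ (Fin m) λ j → embed s w ≡ member r j × lab a w ≡ l × ¬ Inside s (hub r)

  private
    transfer : (s : a ⊑ e) {w w' : Vtx a} {x y z : Vtx e} → embed s w ≡ x → embed s w' ≡ y →
               lab a w ≡ lab a w' → ¬ Inside s z → Edge e x z → Edge e y z
    transfer s refl refl eq = same-label⇒same-outer-edges s eq

  cut-unique : (s : a ⊑ e) → ∀ {r r' t l} → Cut s r t l → Cut s r' t l → r ≡ r'
  cut-unique s {t = fzero} (_ , w≡h , l-w , j , out) (_ , w'≡h' , l-w' , _) =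
    sym (hub-unique (transfer s w≡h w'≡h' (trans l-w (sym l-w')) out (hub-member _ j)))
  cut-unique s {t = fsuc fzero} (_ , j , w≡m , l-w , out) (_ , _ , w'≡m' , l-w' , _) =
    hub-unique (Edge-sym e
      (transfer s w≡m w'≡m' (trans l-w (sym l-w')) out (Edge-sym e (hub-member _ j))))

  data Status (s : a ⊑ e) (r : Fin m) : Set where
    full      : Full s r → Status s r
    untouched : Untouched s r → Status s r
    cut       : ∀ t l → Cut s r t l → Status s r

  status : (s : a ⊑ e) → ∀ r → Status s r
  status {a} s r with inside? s (hub r)
  status {a} s r | yes h with any? (λ j → ¬? (inside? s (member r j)))
  ... | yes (j , out) =
    let w , w≡h = inside-preimage s h in cut fzero (lab a w) (w , w≡h , refl , j , out)
  ... | no none-out =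
    full (h , λ j → decidable-stable (inside? s (member r j)) (λ out → none-out (j , out)))
  status {a} s r | no ¬h with any? (λ j → inside? s (member r j))
  ... | yes (j , j-in) =
    let w , w≡m = inside-preimage s j-in in cut (fsuc fzero) (lab a w) (w , j , w≡m , refl , ¬h)
  ... | no none-in = untouched λ j j-in → none-in (j , j-in)

  untouched-line : 4 * k < m → (s₁ : a ⊑ e) (s₂ : b ⊑ e) → (∀ r → ¬ Full s₁ r) → (∀ r → ¬ Full s₂ r) →
                   Σ (Fin m) λ r → Untouched s₁ r × Untouched s₂ r
  untouched-line 4k<m s₁ s₂ ¬full₁ ¬full₂ with any? (λ r → untouched? s₁ r ×-dec untouched? s₂ r)
  ... | yes found = found
  ... | no none = ⊥-elim (<⇒≱ 4k<m (injective⇒≤ (λ {r} {r'} → same-code (cut-of r) (cut-of r'))))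
    where
    CutIn : Fin m → Fin 2 → Fin 2 → Fin k → Set
    CutIn r fzero        = Cut s₁ r
    CutIn r (fsuc fzero) = Cut s₂ r

    CutOf : Fin m → Set
    CutOf r = Σ (Fin 2) λ side → Σ (Fin 2) λ t → Σ (Fin k) λ l → CutIn r side t l

    cut-of : ∀ r → CutOf r
    cut-of r with status s₁ r | status s₂ r
    ... | full f₁       | _             = ⊥-elim (¬full₁ r f₁)
    ... | _             | full f₂       = ⊥-elim (¬full₂ r f₂)
    ... | cut t l c     | _             = fzero , t , l , c
    ... | untouched _   | cut t l c     = fsuc fzero , t , l , c
    ... | untouched u₁  | untouched u₂  = ⊥-elim (none (r , u₁ , u₂))

    code : ∀ {r} → CutOf r → Fin (4 * k)
    code (side , t , l , _) = combine (combine side t) l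

    same-code : ∀ {r r'} (c : CutOf r) (c' : CutOf r') → code c ≡ code c' → r ≡ r'
    same-code (side , t , l , c) (side' , t' , l' , c') eq
      with combine-injective (combine side t) l (combine side' t') l' eq
    ... | eq-st , refl with combine-injective side t side' t' eq-st
    ... | refl , refl with side
    ...   | fzero      = cut-unique s₁ c c'
    ...   | fsuc fzero = cut-unique s₂ c c'

module _ {G : Graph} {m : ℕ} (S : SubdividedBiclique G m) (H : OnlyOwnHubs S) where

  open SubdividedBiclique S
  open OnlyOwnHubs H

  module _ {k} (4k<m : 4 * k < m) (e : Expr k) (φ : Graph.V G → Vtx e)
           (adj⇒edge : ∀ {x y} → Adj G x y → Edge e (φ x) (φ y))
           (edge⇒adj : ∀ {x y} → Edge e (φ x) (φ y) → Adj G x y) where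

    module Rows = Lines e (φ ∘ rowHub) (λ i j → φ (cell i j))
                        (λ i j → adj⇒edge (rowHub-cell i j)) (rowHub-unique ∘ edge⇒adj)
    module Cols = Lines e (φ ∘ colHub) (λ j i → φ (cell i j))
                        (λ j i → adj⇒edge (colHub-cell i j)) (colHub-unique ∘ edge⇒adj)

    FullLine : ∀ {a} → a ⊑ e → Set
    FullLine s = Σ (Fin m) (Rows.Full s) ⊎ Σ (Fin m) (Cols.Full s)

    FullLine-mono : ∀ {a b} {s : a ⊑ e} {s' : b ⊑ e} → (∀ {z} → Inside s z → Inside s' z) →
                    FullLine s → FullLine s'
    FullLine-mono {s = s} {s'} s⊆s' (inj₁ (r , full)) = inj₁ (r , Rows.Full-mono {s = s} {s'} s⊆s' full)
    FullLine-mono {s = s} {s'} s⊆s' (inj₂ (c , full)) = inj₂ (c , Cols.Full-mono {s = s} {s'} s⊆s' full)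

    -- A full row i would need its cell (i , c₀), and a full column c the cell (r₀ , c).
    no-full-line-⊕ : ∀ {a₁ a₂} (s : a₁ ⊕ a₂ ⊑ e) → ¬ FullLine (⊑-⊕⁻ˡ s) → ¬ FullLine (⊑-⊕⁻ʳ s) →
                     ¬ FullLine s
    no-full-line-⊕ s ¬full₁ ¬full₂ full
      with Rows.untouched-line 4k<m (⊑-⊕⁻ˡ s) (⊑-⊕⁻ʳ s)
             (λ r → ¬full₁ ∘ inj₁ ∘ (r ,_)) (λ r → ¬full₂ ∘ inj₁ ∘ (r ,_))
         | Cols.untouched-line 4k<m (⊑-⊕⁻ˡ s) (⊑-⊕⁻ʳ s)
             (λ c → ¬full₁ ∘ inj₂ ∘ (c ,_)) (λ c → ¬full₂ ∘ inj₂ ∘ (c ,_))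
    ... | r₀ , r₀∉s₁ , r₀∉s₂ | c₀ , c₀∉s₁ , c₀∉s₂ with full
    ...   | inj₁ (i , _ , cells) = [ c₀∉s₁ i , c₀∉s₂ i ]′ (inside-⊕⁻ s (cells c₀))
    ...   | inj₂ (c , _ , cells) = [ r₀∉s₁ c , r₀∉s₂ c ]′ (inside-⊕⁻ s (cells r₀))

    no-full-line : ∀ a (s : a ⊑ e) → ¬ FullLine s
    no-full-line (vert l) s (inj₁ (r , full)) = Rows.Full-vert s r full
    no-full-line (vert l) s (inj₂ (c , full)) = Cols.Full-vert s c full
    no-full-line (a₁ ⊕ a₂) s = no-full-line-⊕ s (no-full-line a₁ (⊑-⊕⁻ˡ s)) (no-full-line a₂ (⊑-⊕⁻ʳ s))
    no-full-line (η i j i≢j a) s full =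
      no-full-line a (⊑-η⁻ s) (FullLine-mono {s = s} {s' = ⊑-η⁻ s} (inside-η⁻ s) full)
    no-full-line (ρ i j a) s full =
      no-full-line a (⊑-ρ⁻ s) (FullLine-mono {s = s} {s' = ⊑-ρ⁻ s} (inside-ρ⁻ s) full)

  cliquewidth-lower-bound : ∀ {k} → 4 * k < m → ¬ CliqueWidth≤ k G
  cliquewidth-lower-bound 4k<m (e , f , iff) =
    no-full-line 4k<m e (Inverse.to f) (Equivalence.to (iff _ _)) (Equivalence.from (iff _ _))
                 e ⊑-refl (inj₁ (fromℕ< 4k<m , tt , λ _ → tt))

module _ (n : ℕ) where

  private
    m : ℕ
    m = length (replicate n (node []))
    C : Graph
    C = Circuit∼ (T n) (T n)

  circuit-biclique : SubdividedBiclique C m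
  circuit-biclique = record
    { rowHub      = λ i → orL here here i
    ; colHub      = λ j → orR here here j
    ; cell        = λ i j → top (child here i) (child here j)
    ; rowHub-cell = λ i j → inj₁ (orL-top i j)
    ; colHub-cell = λ i j → inj₁ (orR-top i j)
    }

  circuit-rows-separated : RowsSeparated circuit-biclique
  circuit-rows-separated = record
    { rowOf        = rowOf
    ; colOf        = colOf
    ; rowOf-rowHub = λ _ → refl
    ; rowOf-cell   = λ _ _ → refl
    ; colOf-colHub = λ _ → refl
    }
    where
    rowOf : CV (T n) (T n) → Maybe (Fin m)
    rowOf (orL here here i)    = just i
    rowOf (top (there i _) _) = just i
    rowOf _                    = nothing
    colOf : CV (T n) (T n) → Maybe (Fin m)
    colOf (orR here here j) = just j
    colOf _                 = nothing

  circuit-only-own-hubs : OnlyOwnHubs circuit-biclique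
  circuit-only-own-hubs = record { rowHub-unique = rowHub-unique ; colHub-unique = colHub-unique }
    where
    open SubdividedBiclique circuit-biclique
    rowHub-unique : ∀ {i' i j} → Adj C (rowHub i') (cell i j) → i' ≡ i
    rowHub-unique (inj₁ (orL-top _ _)) = refl
    rowHub-unique (inj₂ ())
    colHub-unique : ∀ {j' i j} → Adj C (colHub j') (cell i j) → j' ≡ j
    colHub-unique (inj₁ (orR-top _ _)) = refl
    colHub-unique (inj₂ ())

lemma3p4 : ((k : ℕ) → Σ ℕ λ n → (1 ≤ n) × ¬ TreeWidth≤ k (Circuit∼ (T n) (T n)))
    × ((k : ℕ) → Σ ℕ λ n → (1 ≤ n) × ¬ CliqueWidth≤ k (Circuit∼ (T n) (T n)))
lemma3p4 =
  (λ k → suc (suc k) , s≤s z≤n ,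
         treewidth-lower-bound (circuit-biclique _) (circuit-rows-separated _) (≤-width (suc (suc k)))) ,
  (λ k → suc (4 * k) , s≤s z≤n ,
         cliquewidth-lower-bound (circuit-biclique _) (circuit-only-own-hubs _) (≤-width (suc (4 * k))))
  where
  ≤-width : ∀ n → n ≤ length (replicate n (node []))
  ≤-width n = ≤-reflexive (sym (length-replicate n))
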